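{- Let $n$ be a positive integer and let $G$ be a twisted chain graph of order $n$, with vertex sets $A$, $B$, $C$ as in its definition. If each of $A$, $B$, and $C$ is a clique in $G$ and there are no edges between $A$ and $B$, then $G$ is an interval graph.
   Context: All graphs are finite and simple. For a positive integer $n$, a twisted chain graph of order $n$ is a graph on $3n^2$ vertices $A\cup B\cup C$ with $A=\{v_1,\dots,v_{n^2}\}$, $B=\{w_1,\dots,w_{n^2}\}$, $C=\{z_{(i,j)}\colon 1\le i,j\le n\}$ such that: for all $x,y,i,j\in\{1,\dots,n\}$ and $k=n(x-1)+y$, $v_k$ is adjacent to $z_{(i,j)}$ iff ($x<i$) or ($x=i$ and $y\le j$); $w_k$ is adjacent to $z_{(i,j)}$ iff ($x<j$) or ($x=j$ and $y\le i$); and the edge relation within $A\cup B$ and within $C$ is arbitrary. An interval graph is the intersection graph of a family of intervals on the real line. -}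

module Defs where

open import Data.Nat using (ℕ)
open import Data.Fin using (Fin; _<_; _≤_)
open import Data.Product using (_×_; Σ)
open import Data.Sum using (_⊎_)
open import Data.Empty using (⊥)
open import Data.Rational using (ℚ) renaming (_≤_ to _≤ℚ_)
open import Relation.Binary.PropositionalEquality using (_≡_; _≢_)
open import Function.Bundles using (_⇔_)

record IsSimpleGraph (V : Set) (E : V → V → Set) : Set where
  field
    symmetric   : ∀ u v → E u v → E v u
    irreflexive : ∀ v → E v v → ⊥

-- The vertex v_k with k = n(x-1)+y (1 ≤ x,y ≤ n) is  vA (x , y),
-- w_k is  vB (x , y), and z_(i,j) is  vC (i , j); indices are 0-based
-- elements of Fin n (order-preserving shift by 1).
data TVertex (n : ℕ) : Set where
  vA : Fin n → Fin n → TVertex n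
  vB : Fin n → Fin n → TVertex n
  vC : Fin n → Fin n → TVertex n

record IsTwistedChainGraph (n : ℕ) (E : TVertex n → TVertex n → Set) : Set where
  field
    simple : IsSimpleGraph (TVertex n) E
    adjAC  : ∀ x y i j → E (vA x y) (vC i j) ⇔ (x < i ⊎ (x ≡ i × y ≤ j))
    adjBC  : ∀ x y i j → E (vB x y) (vC i j) ⇔ (x < j ⊎ (x ≡ j × y ≤ i))

AIsClique : ∀ {n} → (TVertex n → TVertex n → Set) → Set
AIsClique {n} E = ∀ (x y x' y' : Fin n) → vA x y ≢ vA x' y' → E (vA x y) (vA x' y')

BIsClique : ∀ {n} → (TVertex n → TVertex n → Set) → Set
BIsClique {n} E = ∀ (x y x' y' : Fin n) → vB x y ≢ vB x' y' → E (vB x y) (vB x' y')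

CIsClique : ∀ {n} → (TVertex n → TVertex n → Set) → Set
CIsClique {n} E = ∀ (i j i' j' : Fin n) → vC i j ≢ vC i' j' → E (vC i j) (vC i' j')

NoEdgesAB : ∀ {n} → (TVertex n → TVertex n → Set) → Set
NoEdgesAB {n} E = ∀ (x y x' y' : Fin n) → E (vA x y) (vB x' y') → ⊥

InInterval : ℚ → ℚ → ℚ → Set
InInterval l r q = (l ≤ℚ q) × (q ≤ℚ r)

IsIntervalGraph : (V : Set) → (V → V → Set) → Set
IsIntervalGraph V E =
  Σ (V → ℚ) λ l → Σ (V → ℚ) λ r → ((∀ (v : V) → l v ≤ℚ r v) ×
    (∀ (u v : V) → u ≢ v →
       E u v ⇔ (Σ ℚ λ q → (InInterval (l u) (r u) q × InInterval (l v) (r v) q))))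

module Submission where

-- Number the vertices of A and of B lexicographically by
-- index (x , y) = n·x + y, a bijection onto {0, …, K-1} with K = n².
-- Represent every vertex by an interval with integer endpoints:
--   vA x y  ↦  [ -K , -index x y ]            (all A-intervals contain -K)
--   vB x y  ↦  [ index x y + 1 , K + 1 ]      (all B-intervals contain K+1)
--   vC i j  ↦  [ -index i j , index j i + 1 ] (all C-intervals contain 0)
-- Then A and B are cliques, C is a clique, A-intervals lie left of
-- B-intervals, and vA x y meets vC i j iff index x y ≤ index i j, which is
-- exactly the lexicographic reading of the prescribed adjacency (likewise
-- for B, with the coordinates of z swapped).

open import Defs
open import Data.Nat as ℕ using (ℕ; suc; _+_; _*_)
import Data.Nat.Properties as ℕ
open import Data.Fin as Fin using (Fin; toℕ)
import Data.Fin.Properties as Fin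
open import Data.Integer as ℤ using (ℤ; +_; -_; +≤+)
import Data.Integer.Properties as ℤ
open import Data.Rational as ℚ using (ℚ; mkℚ; *≤*)
import Data.Rational.Properties as ℚ
import Data.Nat.Coprimality as Coprime
open import Data.Product as Product using (_×_; _,_; Σ; swap)
open import Data.Sum as Sum using (_⊎_; inj₁; inj₂)
open import Data.Empty using (⊥; ⊥-elim)
open import Relation.Binary.PropositionalEquality using (_≡_; _≢_; refl; sym; cong; subst₂)
open import Relation.Binary.Definitions using (tri<; tri≈; tri>)
open import Function.Bundles using (_⇔_; mk⇔; Equivalence)
open import Function.Construct.Composition using (_⇔-∘_)
open import Function.Construct.Symmetry using (⇔-sym)

open Equivalence using (to; from)

intervals-meet⇔ : ∀ {l₁ r₁ l₂ r₂ : ℚ} → l₁ ℚ.≤ r₁ → l₂ ℚ.≤ r₂ →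
  (Σ ℚ λ q → InInterval l₁ r₁ q × InInterval l₂ r₂ q) ⇔ (l₁ ℚ.≤ r₂ × l₂ ℚ.≤ r₁)
intervals-meet⇔ {l₁} {r₁} {l₂} {r₂} l₁≤r₁ l₂≤r₂ = mk⇔ necessary sufficient
  where
  necessary : (Σ ℚ λ q → InInterval l₁ r₁ q × InInterval l₂ r₂ q) → l₁ ℚ.≤ r₂ × l₂ ℚ.≤ r₁
  necessary (q , (l₁≤q , q≤r₁) , (l₂≤q , q≤r₂)) = ℚ.≤-trans l₁≤q q≤r₂ , ℚ.≤-trans l₂≤q q≤r₁

  -- the larger left endpoint is a common point
  sufficient : l₁ ℚ.≤ r₂ × l₂ ℚ.≤ r₁ → Σ ℚ λ q → InInterval l₁ r₁ q × InInterval l₂ r₂ q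
  sufficient (l₁≤r₂ , l₂≤r₁) with ℚ.≤-total l₁ l₂
  ... | inj₁ l₁≤l₂ = l₂ , (l₁≤l₂ , l₂≤r₁) , (ℚ.≤-refl , l₂≤r₂)
  ... | inj₂ l₂≤l₁ = l₁ , (ℚ.≤-refl , l₁≤r₁) , (l₂≤l₁ , l₁≤r₂)

ι : ℤ → ℚ
ι z = mkℚ z 0 (Coprime.sym (Coprime.1-coprimeTo _))

ι-≤⇔ : ∀ {a b : ℤ} → a ℤ.≤ b ⇔ ι a ℚ.≤ ι b
ι-≤⇔ {a} {b} = mk⇔
  (λ a≤b → *≤* (subst₂ ℤ._≤_ (sym (ℤ.*-identityʳ a)) (sym (ℤ.*-identityʳ b)) a≤b))
  (λ { (*≤* a≤b) → subst₂ ℤ._≤_ (ℤ.*-identityʳ a) (ℤ.*-identityʳ b) a≤b })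

Overlap : ℤ → ℤ → ℤ → ℤ → Set
Overlap l₁ r₁ l₂ r₂ = l₁ ℤ.≤ r₂ × l₂ ℤ.≤ r₁

overlap⇔meet : ∀ {l₁ r₁ l₂ r₂ : ℤ} → l₁ ℤ.≤ r₁ → l₂ ℤ.≤ r₂ →
  Overlap l₁ r₁ l₂ r₂ ⇔ (Σ ℚ λ q → InInterval (ι l₁) (ι r₁) q × InInterval (ι l₂) (ι r₂) q)
overlap⇔meet l₁≤r₁ l₂≤r₂ =
  ⇔-sym (intervals-meet⇔ (to ι-≤⇔ l₁≤r₁) (to ι-≤⇔ l₂≤r₂)) ⇔-∘
  mk⇔ (Product.map (to ι-≤⇔) (to ι-≤⇔)) (Product.map (from ι-≤⇔) (from ι-≤⇔))

neg-≤⇔ : ∀ {a b : ℕ} → - (+ a) ℤ.≤ - (+ b) ⇔ b ℕ.≤ a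
neg-≤⇔ = mk⇔ (λ le → ℤ.drop‿+≤+ (ℤ.neg-cancel-≤ le)) (λ le → ℤ.neg-mono-≤ (+≤+ le))

suc-≤⇔ : ∀ {a b : ℕ} → + suc a ℤ.≤ + suc b ⇔ a ℕ.≤ b
suc-≤⇔ = mk⇔ (λ le → ℕ.s≤s⁻¹ (ℤ.drop‿+≤+ le)) (λ le → +≤+ (ℕ.s≤s le))

pos≰neg : ∀ {a b : ℕ} → + suc a ℤ.≤ - (+ b) → ⊥
pos≰neg {a} {b} le with ℤ.≤-trans le (ℤ.neg-≤-pos {b} {0})
... | +≤+ ()

leading-digit-dominates : ∀ {n a b c : ℕ} → b ℕ.< n → a ℕ.< c → n * a + b ℕ.< n * c
leading-digit-dominates {n} {a} {b} {c} b<n a<c = begin-strict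
  n * a + b   <⟨ ℕ.+-monoʳ-< (n * a) b<n ⟩
  n * a + n   ≡⟨ ℕ.+-comm (n * a) n ⟩
  n + n * a   ≡⟨ sym (ℕ.*-suc n a) ⟩
  n * suc a   ≤⟨ ℕ.*-monoʳ-≤ n a<c ⟩
  n * c       ∎
  where open ℕ.≤-Reasoning

lexicographic-≤⇔ : ∀ {n a b c d : ℕ} → b ℕ.< n → d ℕ.< n →
  (a ℕ.< c ⊎ (a ≡ c × b ℕ.≤ d)) ⇔ n * a + b ℕ.≤ n * c + d
lexicographic-≤⇔ {n} {a} {b} {c} {d} b<n d<n = mk⇔ compare digits
  where
  compare : a ℕ.< c ⊎ (a ≡ c × b ℕ.≤ d) → n * a + b ℕ.≤ n * c + d
  compare (inj₁ a<c) = ℕ.≤-trans (ℕ.<⇒≤ (leading-digit-dominates b<n a<c)) (ℕ.m≤m+n (n * c) d)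
  compare (inj₂ (refl , b≤d)) = ℕ.+-monoʳ-≤ (n * a) b≤d

  digits : n * a + b ℕ.≤ n * c + d → a ℕ.< c ⊎ (a ≡ c × b ℕ.≤ d)
  digits le with ℕ.<-cmp a c
  ... | tri< a<c _ _ = inj₁ a<c
  ... | tri≈ _ refl _ = inj₂ (refl , ℕ.+-cancelˡ-≤ (n * a) b d le)
  ... | tri> _ _ c<a = ⊥-elim (ℕ.<⇒≱ (leading-digit-dominates d<n c<a)
                                      (ℕ.≤-trans (ℕ.m≤m+n (n * a) b) le))

module Layout (n : ℕ) where

  index : Fin n → Fin n → ℕ
  index x y = n * toℕ x + toℕ y

  K : ℕ
  K = n * n

  index≤K : ∀ x y → index x y ℕ.≤ K
  index≤K x y = ℕ.<⇒≤ (leading-digit-dominates (Fin.toℕ<n y) (Fin.toℕ<n x))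

  index-≤⇔ : ∀ x y i j → (x Fin.< i ⊎ (x ≡ i × y Fin.≤ j)) ⇔ index x y ℕ.≤ index i j
  index-≤⇔ x y i j =
    lexicographic-≤⇔ (Fin.toℕ<n y) (Fin.toℕ<n j) ⇔-∘
    mk⇔ (Sum.map₂ (Product.map₁ (cong toℕ))) (Sum.map₂ (Product.map₁ Fin.toℕ-injective))

  left : TVertex n → ℤ
  left (vA x y) = - (+ K)
  left (vB x y) = + suc (index x y)
  left (vC i j) = - (+ index i j)

  right : TVertex n → ℤ
  right (vA x y) = - (+ index x y)
  right (vB x y) = + suc K
  right (vC i j) = + suc (index j i)

  left≤right : ∀ v → left v ℤ.≤ right v
  left≤right (vA x y) = from neg-≤⇔ (index≤K x y)
  left≤right (vB x y) = from suc-≤⇔ (index≤K x y)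
  left≤right (vC i j) = ℤ.neg-≤-pos

  Overlaps : TVertex n → TVertex n → Set
  Overlaps u v = Overlap (left u) (right u) (left v) (right v)

  overlapsAC⇔ : ∀ x y i j → Overlaps (vA x y) (vC i j) ⇔ index x y ℕ.≤ index i j
  overlapsAC⇔ x y i j = mk⇔ (λ { (_ , le) → to neg-≤⇔ le }) (λ le → ℤ.neg-≤-pos , from neg-≤⇔ le)

  overlapsBC⇔ : ∀ x y i j → Overlaps (vB x y) (vC i j) ⇔ index x y ℕ.≤ index j i
  overlapsBC⇔ x y i j = mk⇔ (λ { (le , _) → to suc-≤⇔ le }) (λ le → from suc-≤⇔ le , ℤ.neg-≤-pos)

  no-overlapAB : ∀ x y x' y' → Overlaps (vA x y) (vB x' y') → ⊥
  no-overlapAB x y x' y' (_ , le) = pos≰neg le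

  -- Each of A, B, C has a common point (-K, K+1 and 0 respectively).
  overlapsAA : ∀ x y x' y' → Overlaps (vA x y) (vA x' y')
  overlapsAA x y x' y' = left≤right (vA x' y') , left≤right (vA x y)

  overlapsBB : ∀ x y x' y' → Overlaps (vB x y) (vB x' y')
  overlapsBB x y x' y' = left≤right (vB x y) , left≤right (vB x' y')

  overlapsCC : ∀ i j i' j' → Overlaps (vC i j) (vC i' j')
  overlapsCC i j i' j' = ℤ.neg-≤-pos , ℤ.neg-≤-pos

  module _ (E : TVertex n → TVertex n → Set) (G : IsTwistedChainGraph n E)
           (cliqueA : AIsClique E) (cliqueB : BIsClique E) (cliqueC : CIsClique E)
           (noAB : NoEdgesAB E) where
    open IsTwistedChainGraph G
    open IsSimpleGraph simple

    flip⇔ : ∀ {u v} → E u v ⇔ Overlaps u v → E v u ⇔ Overlaps v u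
    flip⇔ {u} {v} e = mk⇔ (λ h → swap (to e (symmetric v u h)))
                         (λ o → symmetric u v (from e (swap o)))

    edgeAC⇔ : ∀ x y i j → E (vA x y) (vC i j) ⇔ Overlaps (vA x y) (vC i j)
    edgeAC⇔ x y i j = ⇔-sym (overlapsAC⇔ x y i j) ⇔-∘ (index-≤⇔ x y i j ⇔-∘ adjAC x y i j)

    edgeBC⇔ : ∀ x y i j → E (vB x y) (vC i j) ⇔ Overlaps (vB x y) (vC i j)
    edgeBC⇔ x y i j = ⇔-sym (overlapsBC⇔ x y i j) ⇔-∘ (index-≤⇔ x y j i ⇔-∘ adjBC x y i j)

    edgeAB⇔ : ∀ x y x' y' → E (vA x y) (vB x' y') ⇔ Overlaps (vA x y) (vB x' y')
    edgeAB⇔ x y x' y' = mk⇔ (λ h → ⊥-elim (noAB x y x' y' h))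
                            (λ o → ⊥-elim (no-overlapAB x y x' y' o))

    edge⇔overlaps : ∀ u v → u ≢ v → E u v ⇔ Overlaps u v
    edge⇔overlaps (vA x y) (vA x' y') ne =
      mk⇔ (λ _ → overlapsAA x y x' y') (λ _ → cliqueA x y x' y' ne)
    edge⇔overlaps (vB x y) (vB x' y') ne =
      mk⇔ (λ _ → overlapsBB x y x' y') (λ _ → cliqueB x y x' y' ne)
    edge⇔overlaps (vC i j) (vC i' j') ne =
      mk⇔ (λ _ → overlapsCC i j i' j') (λ _ → cliqueC i j i' j' ne)
    edge⇔overlaps (vA x y) (vB x' y') _ = edgeAB⇔ x y x' y'
    edge⇔overlaps (vB x y) (vA x' y') _ = flip⇔ (edgeAB⇔ x' y' x y)
    edge⇔overlaps (vA x y) (vC i j)   _ = edgeAC⇔ x y i j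
    edge⇔overlaps (vC i j) (vA x y)   _ = flip⇔ (edgeAC⇔ x y i j)
    edge⇔overlaps (vB x y) (vC i j)   _ = edgeBC⇔ x y i j
    edge⇔overlaps (vC i j) (vB x y)   _ = flip⇔ (edgeBC⇔ x y i j)

lemma8 : (n : ℕ) → 1 ℕ.≤ n → (E : TVertex n → TVertex n → Set) →
    IsTwistedChainGraph n E → AIsClique E → BIsClique E → CIsClique E →
    NoEdgesAB E → IsIntervalGraph (TVertex n) E
lemma8 n _ E G cliqueA cliqueB cliqueC noAB =
  (λ v → ι (left v)) , (λ v → ι (right v)) , (λ v → to ι-≤⇔ (left≤right v)) ,
  λ u v u≢v → overlap⇔meet (left≤right u) (left≤right v)
              ⇔-∘ edge⇔overlaps E G cliqueA cliqueB cliqueC noAB u v u≢v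
  where open Layout n
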